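{- Let $L=\perp_i L_i$ be an orthogonal direct sum of finitely many irreducible root lattices $L_i$. Then $m(L)=\min_i m(L_i)$.
   Context: A root lattice is an integral lattice generated by roots, i.e. vectors $v$ with $(v,v)=2$. For a lattice $\Lambda$ of rank $n$, a $2$-frame in $\Lambda$ is a subset $\{\pm v_1,\ldots,\pm v_n\}\subset\Lambda$ with $(v_i,v_j)=2\delta_{ij}$. $m(\Lambda)$ denotes the maximum number of pairwise disjoint $2$-frames in $\Lambda$. $\perp$ denotes orthogonal direct sum. -}

module Defs where

open import Data.Nat using (ℕ; zero; suc; _⊓_) renaming (_+_ to _+ℕ_; _≤_ to _≤ℕ_)
open import Data.Integer using (ℤ; +_; _+_; _*_; -_; _<_)
open import Data.Fin using (Fin; zero; suc; splitAt)
open import Data.Sum using (_⊎_; inj₁; inj₂)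
open import Data.Product using (Σ; _×_; _,_; proj₁)
open import Relation.Nullary using (¬_)
open import Relation.Binary.PropositionalEquality using (_≡_; _≢_)

-- Vectors of ℤ^n (coordinates w.r.t. a fixed ℤ-basis of the lattice).
Vecℤ : ℕ → Set
Vecℤ n = Fin n → ℤ

0v : ∀ {n} → Vecℤ n
0v i = + 0

_+v_ : ∀ {n} → Vecℤ n → Vecℤ n → Vecℤ n
(x +v y) i = x i + y i

-v_ : ∀ {n} → Vecℤ n → Vecℤ n
(-v x) i = - x i

_≈v_ : ∀ {n} → Vecℤ n → Vecℤ n → Set
x ≈v y = ∀ i → x i ≡ y i

∑ : ∀ {n} → (Fin n → ℤ) → ℤ
∑ {zero}  f = + 0
∑ {suc n} f = f zero + ∑ (λ i → f (suc i))

-- A lattice of rank n, given by its (integer) Gram matrix w.r.t. a ℤ-basis.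
record Lat : Set where
  field
    rank : ℕ
    gram : Fin rank → Fin rank → ℤ
open Lat public

form : (L : Lat) → Vecℤ (rank L) → Vecℤ (rank L) → ℤ
form L x y = ∑ (λ i → ∑ (λ j → x i * gram L i j * y j))

IsLattice : Lat → Set
IsLattice L =
  (∀ i j → gram L i j ≡ gram L j i) ×
  (∀ (x : Vecℤ (rank L)) → ¬ (x ≈v 0v) → + 0 < form L x x)

IsRoot : (L : Lat) → Vecℤ (rank L) → Set
IsRoot L v = form L v v ≡ + 2

data InRootSpan (L : Lat) : Vecℤ (rank L) → Set where
  span-0   : InRootSpan L 0v
  span-add : ∀ {x r} → InRootSpan L x → IsRoot L r → InRootSpan L (x +v r)
  span-sub : ∀ {x r} → InRootSpan L x → IsRoot L r → InRootSpan L (x +v (-v r))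

IsRootLattice : Lat → Set
IsRootLattice L = ∀ x → InRootSpan L x

IsSublattice : (L : Lat) → (Vecℤ (rank L) → Set) → Set
IsSublattice L M = M 0v × (∀ x y → M x → M y → M (x +v y)) × (∀ x → M x → M (-v x))

NonzeroSub : (L : Lat) → (Vecℤ (rank L) → Set) → Set
NonzeroSub L M = Σ (Vecℤ (rank L)) λ x → M x × ¬ (x ≈v 0v)

NontrivialOrthDecomp : Lat → Set₁
NontrivialOrthDecomp L =
  Σ (Vecℤ (rank L) → Set) λ M → Σ (Vecℤ (rank L) → Set) λ N →
    IsSublattice L M × IsSublattice L N ×
    NonzeroSub L M × NonzeroSub L N ×
    (∀ x y → M x → N y → form L x y ≡ + 0) ×
    (∀ z → Σ (Vecℤ (rank L)) λ x → Σ (Vecℤ (rank L)) λ y → M x × N y × (z ≈v (x +v y)))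

Irreducible : Lat → Set₁
Irreducible L = (1 ≤ℕ rank L) × ¬ NontrivialOrthDecomp L

-- 2-frame: v₁..v_n with (vᵢ,vⱼ) = 2δᵢⱼ ; the frame is the set {±vᵢ}
IsFrame : (L : Lat) → (Fin (rank L) → Vecℤ (rank L)) → Set
IsFrame L v = (∀ i → form L (v i) (v i) ≡ + 2) × (∀ i j → i ≢ j → form L (v i) (v j) ≡ + 0)

Frame : Lat → Set
Frame L = Σ (Fin (rank L) → Vecℤ (rank L)) (IsFrame L)

DisjointFrames : (L : Lat) → Frame L → Frame L → Set
DisjointFrames L (v , _) (w , _) = ∀ i j → ¬ (v i ≈v w j) × ¬ (v i ≈v (-v (w j)))

PairwiseDisjointFamily : (L : Lat) (m : ℕ) → (Fin m → Frame L) → Set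
PairwiseDisjointFamily L m F = ∀ a b → a ≢ b → DisjointFrames L (F a) (F b)

-- m(L) = m : m is the maximum number of pairwise disjoint 2-frames in L
IsMaxDisjointFrames : Lat → ℕ → Set
IsMaxDisjointFrames L m =
  (Σ (Fin m → Frame L) (PairwiseDisjointFamily L m)) ×
  (∀ m' (F : Fin m' → Frame L) → PairwiseDisjointFamily L m' F → m' ≤ℕ m)

_⊥L_ : Lat → Lat → Lat
rank (L ⊥L M) = rank L +ℕ rank M
gram (L ⊥L M) i j with splitAt (rank L) i | splitAt (rank L) j
... | inj₁ a | inj₁ b = gram L a b
... | inj₂ a | inj₂ b = gram M a b
... | inj₁ _ | inj₂ _ = + 0
... | inj₂ _ | inj₁ _ = + 0

⊥ᵢ : ∀ {k} → (Fin (suc k) → Lat) → Lat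
⊥ᵢ {zero}  L = L zero
⊥ᵢ {suc k} L = L zero ⊥L ⊥ᵢ (λ i → L (suc i))

minᵢ : ∀ {k} → (Fin (suc k) → ℕ) → ℕ
minᵢ {zero}  f = f zero
minᵢ {suc k} f = f zero ⊓ minᵢ (λ i → f (suc i))

-- Only two properties of the summands are used: they are positive definite and
-- even (every root lattice is even, rootLattice-even).  By induction on k it suffices to treat C = A ⊥ B (⊥-max-frames).
-- * m(C) ≥ min (m(A), m(B)): the t-th frame of A next to the t-th frame of B is
--   a frame of C, and these are disjoint for distinct t (combined-disjoint).
-- * m(C) ≤ m(A): a root of C lies in A or in B, since the norms of its two
--   components are nonnegative, even and sum to 2 (root-components).  Pairwise
--   orthogonal roots of B number at most rank B (orthogonal-roots-bound, proved
--   by integer Gaussian elimination), so at least rank A vectors of a 2-frame of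
--   C lie in A, and they form a 2-frame of A (restrict).  Disjoint frames
--   restrict to disjoint frames; symmetrically m(C) ≤ m(B).

module Submission where

open import Defs
open import Data.Nat using (ℕ; zero; suc; _⊓_; s≤s)
import Data.Nat as ℕ
import Data.Nat.Properties as ℕ
open import Data.Integer using (ℤ; +_; -[1+_]; _+_; _*_; -_; _-_)
import Data.Integer as ℤ
open import Data.Integer.Properties
  using (_≟_; +-injective; +-comm; +-assoc; +-identityˡ; +-identityʳ; +-commutativeSemigroup;
         *-zeroʳ; *-zeroˡ; *-distribˡ-+; *-distribʳ-+; neg-distrib-+; neg-distribˡ-*; neg-involutive;
         i*j≡0⇒i≡0∨j≡0; ≤-reflexive; <⇒≤; +-mono-<-≤; +-mono-≤-<)
open import Algebra.Properties.CommutativeSemigroup +-commutativeSemigroup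
  using (interchange; x∙yz≈y∙xz)
open import Data.Integer.Tactic.RingSolver using (solve-∀)
open import Data.Fin using (Fin; zero; suc; punchIn; _↑ˡ_; _↑ʳ_; splitAt; inject≤)
import Data.Fin as Fin
open import Data.Fin.Properties
  using (suc-injective; all?; ¬∀⟶∃¬; inject≤-injective;
         splitAt-↑ˡ; splitAt-↑ʳ; splitAt⁻¹-↑ˡ; splitAt⁻¹-↑ʳ; join-splitAt)
open import Data.Vec.Functional using (insertAt)
open import Data.Vec.Functional.Properties using (insertAt-lookup; insertAt-punchIn)
open import Data.Product using (Σ; _×_; _,_; proj₁; proj₂)
open import Data.Sum using (_⊎_; inj₁; inj₂; [_,_]′)
open import Data.Empty using (⊥-elim)
open import Function using (_∘_)
open import Relation.Nullary using (¬_; yes; no)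
open import Relation.Unary using (Decidable)
open import Relation.Binary.PropositionalEquality
open ≡-Reasoning

∑-cong : ∀ {n} {f g : Fin n → ℤ} → (∀ i → f i ≡ g i) → ∑ f ≡ ∑ g
∑-cong {zero}  e = refl
∑-cong {suc n} e = cong₂ _+_ (e zero) (∑-cong (e ∘ suc))

∑-zero : ∀ {n} {f : Fin n → ℤ} → (∀ i → f i ≡ + 0) → ∑ f ≡ + 0
∑-zero {zero}  e = refl
∑-zero {suc n} e = cong₂ _+_ (e zero) (∑-zero (e ∘ suc))

∑-+ : ∀ {n} (f g : Fin n → ℤ) → ∑ (λ i → f i + g i) ≡ ∑ f + ∑ g
∑-+ {zero}  f g = refl
∑-+ {suc n} f g = trans (cong (_+_ (f zero + g zero)) (∑-+ (f ∘ suc) (g ∘ suc)))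
                        (interchange (f zero) (g zero) (∑ (f ∘ suc)) (∑ (g ∘ suc)))

∑-*ˡ : ∀ {n} (c : ℤ) (f : Fin n → ℤ) → ∑ (λ i → c * f i) ≡ c * ∑ f
∑-*ˡ {zero}  c f = sym (*-zeroʳ c)
∑-*ˡ {suc n} c f = trans (cong (_+_ (c * f zero)) (∑-*ˡ c (f ∘ suc)))
                         (sym (*-distribˡ-+ c (f zero) (∑ (f ∘ suc))))

∑-*ʳ : ∀ {n} (c : ℤ) (f : Fin n → ℤ) → ∑ (λ i → f i * c) ≡ ∑ f * c
∑-*ʳ {zero}  c f = refl
∑-*ʳ {suc n} c f = trans (cong (_+_ (f zero * c)) (∑-*ʳ c (f ∘ suc)))
                         (sym (*-distribʳ-+ c (f zero) (∑ (f ∘ suc))))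

∑-neg : ∀ {n} (f : Fin n → ℤ) → ∑ (λ i → - f i) ≡ - ∑ f
∑-neg {zero}  f = refl
∑-neg {suc n} f = trans (cong (_+_ (- f zero)) (∑-neg (f ∘ suc))) (sym (neg-distrib-+ (f zero) _))

∑-swap : ∀ {m n} (f : Fin m → Fin n → ℤ) →
  ∑ (λ i → ∑ (λ j → f i j)) ≡ ∑ (λ j → ∑ (λ i → f i j))
∑-swap {zero}  {n} f = sym (∑-zero {n} (λ _ → refl))
∑-swap {suc m} {n} f = trans (cong (_+_ (∑ (f zero))) (∑-swap (f ∘ suc)))
                             (sym (∑-+ (f zero) (λ j → ∑ (λ i → f (suc i) j))))

∑-split : ∀ m {n} (f : Fin (m ℕ.+ n) → ℤ) →
  ∑ f ≡ ∑ (λ i → f (i ↑ˡ n)) + ∑ (λ i → f (m ↑ʳ i))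
∑-split zero    f = sym (+-identityˡ (∑ f))
∑-split (suc m) f = trans (cong (_+_ (f zero)) (∑-split m (f ∘ suc)))
                          (sym (+-assoc (f zero) _ _))

∑-single : ∀ {n} (f : Fin n → ℤ) (k : Fin n) → (∀ j → j ≢ k → f j ≡ + 0) → ∑ f ≡ f k
∑-single {suc n} f zero    h = trans (cong (_+_ (f zero)) (∑-zero (λ i → h (suc i) (λ ()))))
                                     (+-identityʳ (f zero))
∑-single {suc n} f (suc k) h =
  trans (cong₂ _+_ (h zero (λ ()))
                   (∑-single (f ∘ suc) k (λ j j≢k → h (suc j) (j≢k ∘ suc-injective))))
        (+-identityˡ (f (suc k)))

∑-pull : ∀ {n} (f : Fin (suc n) → ℤ) (p : Fin (suc n)) → ∑ f ≡ f p + ∑ (f ∘ punchIn p)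
∑-pull         f zero    = refl
∑-pull {suc n} f (suc p) = trans (cong (_+_ (f zero)) (∑-pull (f ∘ suc) p))
                                 (x∙yz≈y∙xz (f zero) (f (suc p)) _)

comb : ∀ {s r} → (Fin s → ℤ) → (Fin s → Vecℤ r) → Vecℤ r
comb a u i = ∑ (λ j → a j * u j i)

module _ (L : Lat) where
  private
    G = gram L
    entry : Vecℤ (rank L) → Vecℤ (rank L) → Fin (rank L) → Fin (rank L) → ℤ
    entry x y i j = x i * G i j * y j

  form-cong : ∀ {x x' y y'} → x ≈v x' → y ≈v y' → form L x y ≡ form L x' y'
  form-cong ex ey = ∑-cong (λ i → ∑-cong (λ j → cong₂ (λ a b → a * G i j * b) (ex i) (ey j)))

  form-0ˡ : ∀ {x} y → x ≈v 0v → form L x y ≡ + 0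
  form-0ˡ y ex = ∑-zero (λ i → ∑-zero (λ j → cong (λ a → a * G i j * y j) (ex i)))

  form-0ʳ : ∀ x {y} → y ≈v 0v → form L x y ≡ + 0
  form-0ʳ x ey =
    ∑-zero (λ i → ∑-zero (λ j → trans (cong (x i * G i j *_) (ey j)) (*-zeroʳ (x i * G i j))))

  form-+ˡ : ∀ x y z → form L (x +v y) z ≡ form L x z + form L y z
  form-+ˡ x y z =
    trans (∑-cong (λ i → trans (∑-cong (λ j → distrib (x i) (y i) (G i j) (z j)))
                               (∑-+ (entry x z i) (entry y z i))))
          (∑-+ (λ i → ∑ (entry x z i)) (λ i → ∑ (entry y z i)))
    where
      distrib : ∀ a b g c → (a + b) * g * c ≡ a * g * c + b * g * c
      distrib = solve-∀

  form-+ʳ : ∀ x y z → form L x (y +v z) ≡ form L x y + form L x z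
  form-+ʳ x y z =
    trans (∑-cong (λ i → trans (∑-cong (λ j → distrib (x i) (G i j) (y j) (z j)))
                               (∑-+ (entry x y i) (entry x z i))))
          (∑-+ (λ i → ∑ (entry x y i)) (λ i → ∑ (entry x z i)))
    where
      distrib : ∀ a g b c → a * g * (b + c) ≡ a * g * b + a * g * c
      distrib = solve-∀

  form-negˡ : ∀ x y → form L (-v x) y ≡ - form L x y
  form-negˡ x y =
    trans (∑-cong (λ i → trans (∑-cong (λ j → pull (x i) (G i j) (y j)))
                               (∑-neg (entry x y i))))
          (∑-neg (λ i → ∑ (entry x y i)))
    where
      pull : ∀ a g b → (- a) * g * b ≡ - (a * g * b)
      pull = solve-∀

  form-negʳ : ∀ x y → form L x (-v y) ≡ - form L x y
  form-negʳ x y =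
    trans (∑-cong (λ i → trans (∑-cong (λ j → pull (x i) (G i j) (y j)))
                               (∑-neg (entry x y i))))
          (∑-neg (λ i → ∑ (entry x y i)))
    where
      pull : ∀ a g b → a * g * (- b) ≡ - (a * g * b)
      pull = solve-∀

  form-sym : (∀ i j → G i j ≡ G j i) → ∀ x y → form L x y ≡ form L y x
  form-sym G-sym x y = trans (∑-swap (entry x y)) (∑-cong (λ i → ∑-cong (λ j → transpose i j)))
    where
      reorder : ∀ a g b → a * g * b ≡ b * g * a
      reorder = solve-∀
      transpose : ∀ i j → x j * G j i * y i ≡ y i * G i j * x j
      transpose i j = trans (cong (λ g → x j * g * y i) (G-sym j i)) (reorder (x j) (G i j) (y i))

  form-comb : ∀ {s} (a : Fin s → ℤ) (u : Fin s → Vecℤ (rank L)) y →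
    form L (comb a u) y ≡ ∑ (λ j → a j * form L (u j) y)
  form-comb a u y = begin
      ∑ (λ i → ∑ (λ l → comb a u i * G i l * y l))
    ≡⟨ ∑-cong (λ i → ∑-cong (λ l → expand i l)) ⟩
      ∑ (λ i → ∑ (λ l → ∑ (λ j → a j * entry (u j) y i l)))
    ≡⟨ ∑-cong (λ i → ∑-swap (λ l j → a j * entry (u j) y i l)) ⟩
      ∑ (λ i → ∑ (λ j → ∑ (λ l → a j * entry (u j) y i l)))
    ≡⟨ ∑-swap (λ i j → ∑ (λ l → a j * entry (u j) y i l)) ⟩
      ∑ (λ j → ∑ (λ i → ∑ (λ l → a j * entry (u j) y i l)))
    ≡⟨ ∑-cong (λ j → trans (∑-cong (λ i → ∑-*ˡ (a j) (entry (u j) y i)))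
                            (∑-*ˡ (a j) (λ i → ∑ (entry (u j) y i)))) ⟩
      ∑ (λ j → a j * form L (u j) y)
    ∎
    where
      reassoc : ∀ a b g c → a * b * g * c ≡ a * (b * g * c)
      reassoc = solve-∀
      expand : ∀ i l → comb a u i * G i l * y l ≡ ∑ (λ j → a j * entry (u j) y i l)
      expand i l = begin
          ∑ (λ j → a j * u j i) * G i l * y l
        ≡⟨ cong (_* y l) (∑-*ʳ (G i l) (λ j → a j * u j i)) ⟨
          ∑ (λ j → a j * u j i * G i l) * y l
        ≡⟨ ∑-*ʳ (y l) (λ j → a j * u j i * G i l) ⟨
          ∑ (λ j → a j * u j i * G i l * y l)
        ≡⟨ ∑-cong (λ j → reassoc (a j) (u j i) (G i l) (y l)) ⟩
          ∑ (λ j → a j * entry (u j) y i l)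
        ∎

  norm-+root : (∀ i j → G i j ≡ G j i) →
    ∀ {x y} t → form L x x ≡ t + t → form L y y ≡ + 2 →
    form L (x +v y) (x +v y) ≡ (t + form L x y + + 1) + (t + form L x y + + 1)
  norm-+root G-sym {x} {y} t x-even y-root = begin
      form L (x +v y) (x +v y)
    ≡⟨ trans (form-+ˡ x y (x +v y)) (cong₂ _+_ (form-+ʳ x x y) (form-+ʳ y x y)) ⟩
      (form L x x + form L x y) + (form L y x + form L y y)
    ≡⟨ cong₂ (λ a b → (a + form L x y) + b) x-even
             (cong₂ _+_ (form-sym G-sym y x) y-root) ⟩
      ((t + t) + form L x y) + (form L x y + + 2)
    ≡⟨ regroup t (form L x y) ⟩
      (t + form L x y + + 1) + (t + form L x y + + 1)
    ∎
    where
      regroup : ∀ t f → ((t + t) + f) + (f + + 2) ≡ (t + f + + 1) + (t + f + + 1)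
      regroup = solve-∀

Even : Lat → Set
Even L = ∀ x → Σ ℤ λ t → form L x x ≡ t + t

PositiveDefinite : Lat → Set
PositiveDefinite L = ∀ x → ¬ (x ≈v 0v) → + 0 ℤ.< form L x x

-- A root lattice is even: the roots have norm 2 and the norm stays even
-- when a root is added or subtracted.
rootLattice-even : ∀ {L} → IsLattice L → IsRootLattice L → Even L
rootLattice-even {L} (G-sym , _) generated x = span-even (generated x)
  where
    neg-root : ∀ {r} → IsRoot L r → IsRoot L (-v r)
    neg-root {r} r-root = begin
        form L (-v r) (-v r)
      ≡⟨ trans (form-negˡ L r (-v r)) (cong -_ (form-negʳ L r r)) ⟩
        - - form L r r
      ≡⟨ neg-involutive (form L r r) ⟩
        form L r r
      ≡⟨ r-root ⟩
        + 2
      ∎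
    span-even : ∀ {x} → InRootSpan L x → Σ ℤ λ t → form L x x ≡ t + t
    span-even span-0 = + 0 , form-0ˡ L 0v (λ _ → refl)
    span-even (span-add {x} {r} sp r-root) with span-even sp
    ... | t , x-even = t + form L x r + + 1 , norm-+root L G-sym {x} {r} t x-even r-root
    span-even (span-sub {x} {r} sp r-root) with span-even sp
    ... | t , x-even =
      t + form L x (-v r) + + 1 , norm-+root L G-sym {x} { -v r} t x-even (neg-root {r} r-root)

module _ {L : Lat} where

  root-nonzero : ∀ {x} → form L x x ≡ + 2 → ¬ (x ≈v 0v)
  root-nonzero {x} x-root x≈0 with trans (sym x-root) (form-0ˡ L x x≈0)
  ... | ()

  form-nonneg : PositiveDefinite L → ∀ x → + 0 ℤ.≤ form L x x
  form-nonneg pd x with all? (λ i → x i ≟ + 0)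
  ... | yes x≈0 = ≤-reflexive (sym (form-0ˡ L x x≈0))
  ... | no  x≉0 = <⇒≤ (pd x x≉0)

  norm-zero : PositiveDefinite L → ∀ {x} → form L x x ≡ + 0 → x ≈v 0v
  norm-zero pd {x} x-null with all? (λ i → x i ≟ + 0)
  ... | yes x≈0 = x≈0
  ... | no  x≉0 with subst (+ 0 ℤ.<_) x-null (pd x x≉0)
  ...   | ℤ.+<+ ()

≈v-trans : ∀ {n} {x y z : Vecℤ n} → x ≈v y → y ≈v z → x ≈v z
≈v-trans e e′ i = trans (e i) (e′ i)

-v-cong : ∀ {n} {x y : Vecℤ n} → x ≈v y → (-v x) ≈v (-v y)
-v-cong e i = cong -_ (e i)

Dependent : ∀ {s r} → (Fin s → Vecℤ r) → Set
Dependent {s} u = Σ (Fin s → ℤ) λ a → (comb a u ≈v 0v) × Σ (Fin s) λ k → a k ≢ + 0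

dependent-from-tails : ∀ {s r} (u : Fin s → Vecℤ (suc r)) → (∀ j → u j zero ≡ + 0) →
  Dependent (λ j → u j ∘ suc) → Dependent u
dependent-from-tails u first-zero (a , tail-rel , k , ak≢0) = a , rel , k , ak≢0
  where
    rel : comb a u ≈v 0v
    rel zero    = ∑-zero (λ j → trans (cong (a j *_) (first-zero j)) (*-zeroʳ (a j)))
    rel (suc i) = tail-rel i

-- One step of Gaussian elimination with pivot u p: the vectors
-- cₚ u_{p'} − c_{p'} uₚ (p' ≠ p, c = first coordinates) have first coordinate 0.
eliminate : ∀ {s r} → (Fin (suc s) → Vecℤ (suc r)) → Fin (suc s) → Fin s → Vecℤ (suc r)
eliminate u p j i = u p zero * u (punchIn p j) i - u (punchIn p j) zero * u p i

eliminate-first : ∀ {s r} (u : Fin (suc s) → Vecℤ (suc r)) p j → eliminate u p j zero ≡ + 0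
eliminate-first u p j = cancel (u p zero) (u (punchIn p j) zero)
  where
    cancel : ∀ a b → a * b - b * a ≡ + 0
    cancel = solve-∀

-- Coefficients b of the eliminated vectors, rewritten as coefficients of the
-- original ones: cₚ bⱼ at punchIn p j, and −∑ⱼ bⱼ c_{punchIn p j} at p.
lift-coefficients : ∀ {s r} → (Fin (suc s) → Vecℤ (suc r)) → Fin (suc s) →
  (Fin s → ℤ) → Fin (suc s) → ℤ
lift-coefficients u p b =
  insertAt (λ j → u p zero * b j) p (- ∑ (λ j → b j * u (punchIn p j) zero))

comb-lift : ∀ {s r} (u : Fin (suc s) → Vecℤ (suc r)) p b →
  comb (lift-coefficients u p b) u ≈v comb b (eliminate u p)
comb-lift u p b i = begin
    comb a u i
  ≡⟨ ∑-pull (λ x → a x * u x i) p ⟩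
    a p * P + ∑ (λ j → a (punchIn p j) * U j)
  ≡⟨ cong₂ _+_ (cong (_* P) (insertAt-lookup a′ p (- S)))
               (∑-cong (λ j → cong (_* U j) (insertAt-punchIn a′ p (- S) j))) ⟩
    - S * P + ∑ (λ j → c p * b j * U j)
  ≡⟨ +-comm (- S * P) _ ⟩
    ∑ (λ j → c p * b j * U j) + - S * P
  ≡⟨ cong (_+_ (∑ (λ j → c p * b j * U j))) (neg-distribˡ-* S P) ⟨
    ∑ (λ j → c p * b j * U j) + - (S * P)
  ≡⟨ cong (λ t → ∑ (λ j → c p * b j * U j) + - t) (∑-*ʳ P (λ j → b j * c (punchIn p j))) ⟨
    ∑ (λ j → c p * b j * U j) + - ∑ (λ j → b j * c (punchIn p j) * P)
  ≡⟨ cong (_+_ (∑ (λ j → c p * b j * U j))) (∑-neg (λ j → b j * c (punchIn p j) * P)) ⟨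
    ∑ (λ j → c p * b j * U j) + ∑ (λ j → - (b j * c (punchIn p j) * P))
  ≡⟨ ∑-+ (λ j → c p * b j * U j) (λ j → - (b j * c (punchIn p j) * P)) ⟨
    ∑ (λ j → c p * b j * U j + - (b j * c (punchIn p j) * P))
  ≡⟨ ∑-cong (λ j → termwise (c p) (b j) (U j) (c (punchIn p j)) P) ⟩
    comb b (eliminate u p) i
  ∎
  where
    a  = lift-coefficients u p b
    a′ = λ j → u p zero * b j
    c  = λ j → u j zero
    S  = ∑ (λ j → b j * c (punchIn p j))
    P  = u p i
    U  = λ j → u (punchIn p j) i
    termwise : ∀ cp bj x cj y → cp * bj * x + - (bj * cj * y) ≡ bj * (cp * x - cj * y)
    termwise = solve-∀

dependent-from-elimination : ∀ {s r} (u : Fin (suc s) → Vecℤ (suc r)) p →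
  u p zero ≢ + 0 → Dependent (eliminate u p) → Dependent u
dependent-from-elimination u p cp≢0 (b , b-rel , k , bk≢0) =
  lift-coefficients u p b , (λ i → trans (comb-lift u p b i) (b-rel i)) , punchIn p k , nonzero
  where
    nonzero : lift-coefficients u p b (punchIn p k) ≢ + 0
    nonzero e with i*j≡0⇒i≡0∨j≡0 (u p zero)
                     (trans (sym (insertAt-punchIn (λ j → u p zero * b j) p _ k)) e)
    ... | inj₁ cp≡0 = cp≢0 cp≡0
    ... | inj₂ bk≡0 = bk≢0 bk≡0

dependent : ∀ r {s} → r ℕ.< s → (u : Fin s → Vecℤ r) → Dependent u
dependent zero    {suc s} _         u = (λ _ → + 1) , (λ ()) , zero , (λ ())
dependent (suc r) {suc s} (s≤s r<s) u with all? (λ j → u j zero ≟ + 0)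
... | yes first-zero =
  dependent-from-tails u first-zero (dependent r (ℕ.m<n⇒m<1+n r<s) (λ j → u j ∘ suc))
... | no first-nonzero with ¬∀⟶∃¬ (suc s) _ (λ j → u j zero ≟ + 0) first-nonzero
...   | p , cp≢0 = dependent-from-elimination u p cp≢0
          (dependent-from-tails (eliminate u p) (eliminate-first u p)
            (dependent r r<s (λ j → eliminate u p j ∘ suc)))

-- Pairing a relation ∑ aⱼ uⱼ = 0 among pairwise orthogonal vectors of norm 2
-- with u k gives 2 aₖ = 0.
orthogonal-roots-relation : ∀ L {s} (u : Fin s → Vecℤ (rank L)) →
  (∀ j → form L (u j) (u j) ≡ + 2) → (∀ j k → j ≢ k → form L (u j) (u k) ≡ + 0) →
  ∀ a → comb a u ≈v 0v → ∀ k → a k * + 2 ≡ + 0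
orthogonal-roots-relation L u norm orth a a-rel k = begin
    a k * + 2
  ≡⟨ cong (a k *_) (norm k) ⟨
    a k * form L (u k) (u k)
  ≡⟨ ∑-single (λ j → a j * form L (u j) (u k)) k
       (λ j j≢k → trans (cong (a j *_) (orth j k j≢k)) (*-zeroʳ (a j))) ⟨
    ∑ (λ j → a j * form L (u j) (u k))
  ≡⟨ form-comb L a u (u k) ⟨
    form L (comb a u) (u k)
  ≡⟨ form-0ˡ L (u k) a-rel ⟩
    + 0
  ∎

orthogonal-roots-bound : ∀ L {s} (u : Fin s → Vecℤ (rank L)) →
  (∀ j → form L (u j) (u j) ≡ + 2) → (∀ j k → j ≢ k → form L (u j) (u k) ≡ + 0) →
  s ℕ.≤ rank L
orthogonal-roots-bound L {s} u norm orth with s ℕ.≤? rank L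
... | yes s≤r = s≤r
... | no  s≰r with dependent (rank L) (ℕ.≰⇒> s≰r) u
...   | a , a-rel , k , ak≢0
      with i*j≡0⇒i≡0∨j≡0 (a k) (orthogonal-roots-relation L u norm orth a a-rel k)
...     | inj₁ ak≡0 = ⊥-elim (ak≢0 ak≡0)
...     | inj₂ ()

record Enumeration {n} (P : Fin n → Set) : Set where
  field
    size      : ℕ
    index     : Fin size → Fin n
    holds     : ∀ j → P (index j)
    injective : ∀ j k → index j ≡ index k → j ≡ k
open Enumeration

module _ {n} {P : Fin (suc n) → Set} where

  skip-zero : Enumeration (P ∘ suc) → Enumeration P
  skip-zero E = record
    { size      = size E
    ; index     = suc ∘ index E
    ; holds     = holds E
    ; injective = λ j k → injective E j k ∘ suc-injective
    }

  take-zero : P zero → Enumeration (P ∘ suc) → Enumeration P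
  take-zero p0 E = record
    { size = suc (size E) ; index = index′ ; holds = holds′ ; injective = injective′ }
    where
      index′ : Fin (suc (size E)) → Fin (suc n)
      index′ zero    = zero
      index′ (suc j) = suc (index E j)
      holds′ : ∀ j → P (index′ j)
      holds′ zero    = p0
      holds′ (suc j) = holds E j
      injective′ : ∀ j k → index′ j ≡ index′ k → j ≡ k
      injective′ zero    zero    _ = refl
      injective′ (suc j) (suc k) e = cong suc (injective E j k (suc-injective e))

partition : ∀ n {P : Fin n → Set} → Decidable P →
  Σ (Enumeration P) λ yes-part → Σ (Enumeration (¬_ ∘ P)) λ no-part →
    size yes-part ℕ.+ size no-part ≡ n
partition zero    P? = none , none , refl
  where
    none : ∀ {Q : Fin 0 → Set} → Enumeration Q
    none = record { size = 0 ; index = λ () ; holds = λ () ; injective = λ () }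
partition (suc n) P? with partition n (P? ∘ suc) | P? zero
... | E , E′ , sizes | yes p0 = take-zero p0 E , skip-zero E′ , cong suc sizes
... | E , E′ , sizes | no ¬p0 =
  skip-zero E , take-zero ¬p0 E′ , trans (ℕ.+-suc (size E) (size E′)) (cong suc sizes)

record OrthogonalSplitting (C A B : Lat) : Set where
  field
    π : Vecℤ (rank C) → Vecℤ (rank A)
    ρ : Vecℤ (rank C) → Vecℤ (rank B)
    form-split : ∀ z w → form C z w ≡ form A (π z) (π w) + form B (ρ z) (ρ w)
    π-neg : ∀ z → π (-v z) ≈v (-v (π z))
    ρ-neg : ∀ z → ρ (-v z) ≈v (-v (ρ z))
    components-determine : ∀ {z w} → π z ≈v π w → ρ z ≈v ρ w → z ≈v w
    rank-split : rank C ≡ rank A ℕ.+ rank B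

swap-splitting : ∀ {C A B} → OrthogonalSplitting C A B → OrthogonalSplitting C B A
swap-splitting {C} {A} {B} S = record
  { π = ρ
  ; ρ = π
  ; form-split = λ z w →
      trans (form-split z w) (+-comm (form A (π z) (π w)) (form B (ρ z) (ρ w)))
  ; π-neg = ρ-neg
  ; ρ-neg = π-neg
  ; components-determine = λ eρ eπ → components-determine eπ eρ
  ; rank-split = trans rank-split (ℕ.+-comm (rank A) (rank B))
  }
  where open OrthogonalSplitting S

module _ (A B : Lat) where
  private
    ra = rank A
    rb = rank B
    C  = A ⊥L B

  left : Vecℤ (rank C) → Vecℤ ra
  left z i = z (i ↑ˡ rb)

  right : Vecℤ (rank C) → Vecℤ rb
  right z i = z (ra ↑ʳ i)

  join : Vecℤ ra → Vecℤ rb → Vecℤ (rank C)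
  join x y i = [ x , y ]′ (splitAt ra i)

  left-join : ∀ x y → left (join x y) ≈v x
  left-join x y i rewrite splitAt-↑ˡ ra i rb = refl

  right-join : ∀ x y → right (join x y) ≈v y
  right-join x y i rewrite splitAt-↑ʳ ra rb i = refl

  left-of : ∀ {x y z} → join x y ≈v z → x ≈v left z
  left-of {x} {y} e k = trans (sym (left-join x y k)) (e (k ↑ˡ rb))

  right-of : ∀ {x y z} → join x y ≈v z → y ≈v right z
  right-of {x} {y} e k = trans (sym (right-join x y k)) (e (ra ↑ʳ k))

  left-right-determine : ∀ {z w} → left z ≈v left w → right z ≈v right w → z ≈v w
  left-right-determine {z} {w} el er i with splitAt ra i in eq
  ... | inj₁ a = subst (λ k → z k ≡ w k) (splitAt⁻¹-↑ˡ eq) (el a)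
  ... | inj₂ b = subst (λ k → z k ≡ w k) (splitAt⁻¹-↑ʳ eq) (er b)

  gram-AA : ∀ i j → gram C (i ↑ˡ rb) (j ↑ˡ rb) ≡ gram A i j
  gram-AA i j rewrite splitAt-↑ˡ ra i rb | splitAt-↑ˡ ra j rb = refl

  gram-AB : ∀ i j → gram C (i ↑ˡ rb) (ra ↑ʳ j) ≡ + 0
  gram-AB i j rewrite splitAt-↑ˡ ra i rb | splitAt-↑ʳ ra rb j = refl

  gram-BA : ∀ i j → gram C (ra ↑ʳ i) (j ↑ˡ rb) ≡ + 0
  gram-BA i j rewrite splitAt-↑ʳ ra rb i | splitAt-↑ˡ ra j rb = refl

  gram-BB : ∀ i j → gram C (ra ↑ʳ i) (ra ↑ʳ j) ≡ gram B i j
  gram-BB i j rewrite splitAt-↑ʳ ra rb i | splitAt-↑ʳ ra rb j = refl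

  form-⊥ : ∀ z w → form C z w ≡ form A (left z) (left w) + form B (right z) (right w)
  form-⊥ z w = trans (∑-split ra (λ I → ∑ (λ J → z I * gram C I J * w J)))
                     (cong₂ _+_ (∑-cong A-row) (∑-cong B-row))
    where
      vanish : ∀ a {g} b → g ≡ + 0 → a * g * b ≡ + 0
      vanish a b g≡0 =
        trans (cong (λ g → a * g * b) g≡0) (trans (cong (_* b) (*-zeroʳ a)) (*-zeroˡ b))
      A-row : ∀ i → ∑ (λ J → left z i * gram C (i ↑ˡ rb) J * w J)
                  ≡ ∑ (λ j → left z i * gram A i j * left w j)
      A-row i = trans (∑-split ra (λ J → left z i * gram C (i ↑ˡ rb) J * w J))
        (trans (cong₂ _+_ (∑-cong (λ j → cong (λ g → left z i * g * left w j) (gram-AA i j)))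
                          (∑-zero (λ j → vanish (left z i) (right w j) (gram-AB i j))))
               (+-identityʳ _))
      B-row : ∀ i → ∑ (λ J → right z i * gram C (ra ↑ʳ i) J * w J)
                  ≡ ∑ (λ j → right z i * gram B i j * right w j)
      B-row i = trans (∑-split ra (λ J → right z i * gram C (ra ↑ʳ i) J * w J))
        (trans (cong₂ _+_ (∑-zero (λ j → vanish (right z i) (left w j) (gram-BA i j)))
                          (∑-cong (λ j → cong (λ g → right z i * g * right w j) (gram-BB i j))))
               (+-identityˡ _))

  form-join : ∀ x y x′ y′ → form C (join x y) (join x′ y′) ≡ form A x x′ + form B y y′
  form-join x y x′ y′ = trans (form-⊥ (join x y) (join x′ y′))
    (cong₂ _+_ (form-cong A (left-join x y) (left-join x′ y′))
               (form-cong B (right-join x y) (right-join x′ y′)))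

  ⊥-splitting : OrthogonalSplitting C A B
  ⊥-splitting = record
    { π = left
    ; ρ = right
    ; form-split = form-⊥
    ; π-neg = λ _ _ → refl
    ; ρ-neg = λ _ _ → refl
    ; components-determine = left-right-determine
    ; rank-split = refl
    }

  ⊥-even : Even A → Even B → Even C
  ⊥-even evA evB z with evA (left z) | evB (right z)
  ... | s , s-even | t , t-even =
    s + t , trans (form-⊥ z z) (trans (cong₂ _+_ s-even t-even) (interchange s s t t))

  ⊥-positive : PositiveDefinite A → PositiveDefinite B → PositiveDefinite C
  ⊥-positive pdA pdB z z≉0 rewrite form-⊥ z z with all? (λ i → left z i ≟ + 0)
  ... | no  left≉0 = +-mono-<-≤ (pdA (left z) left≉0) (form-nonneg pdB (right z))
  ... | yes left≈0 with all? (λ i → right z i ≟ + 0)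
  ...   | yes right≈0 = ⊥-elim (z≉0 (left-right-determine left≈0 right≈0))
  ...   | no  right≉0 = +-mono-≤-< (form-nonneg pdA (left z)) (pdB (right z) right≉0)

  slot : Frame A → Frame B → Fin ra ⊎ Fin rb → Vecℤ (rank C)
  slot FA FB (inj₁ p) = join (proj₁ FA p) 0v
  slot FA FB (inj₂ q) = join 0v (proj₁ FB q)

  slot-norm : ∀ FA FB s → form C (slot FA FB s) (slot FA FB s) ≡ + 2
  slot-norm FA FB (inj₁ p) =
    trans (form-join _ _ _ _) (cong₂ _+_ (proj₁ (proj₂ FA) p) (form-0ˡ B 0v (λ _ → refl)))
  slot-norm FA FB (inj₂ q) =
    trans (form-join _ _ _ _) (cong₂ _+_ (form-0ˡ A 0v (λ _ → refl)) (proj₁ (proj₂ FB) q))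

  slot-orth : ∀ FA FB s s′ → s ≢ s′ → form C (slot FA FB s) (slot FA FB s′) ≡ + 0
  slot-orth FA FB (inj₁ p) (inj₁ p′) s≢s′ = trans (form-join _ _ _ _)
    (cong₂ _+_ (proj₂ (proj₂ FA) p p′ (s≢s′ ∘ cong inj₁)) (form-0ˡ B 0v (λ _ → refl)))
  slot-orth FA FB (inj₁ p) (inj₂ q) _ = trans (form-join _ _ _ _)
    (cong₂ _+_ (form-0ʳ A (proj₁ FA p) (λ _ → refl)) (form-0ˡ B (proj₁ FB q) (λ _ → refl)))
  slot-orth FA FB (inj₂ q) (inj₁ p) _ = trans (form-join _ _ _ _)
    (cong₂ _+_ (form-0ˡ A (proj₁ FA p) (λ _ → refl)) (form-0ʳ B (proj₁ FB q) (λ _ → refl)))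
  slot-orth FA FB (inj₂ q) (inj₂ q′) s≢s′ = trans (form-join _ _ _ _)
    (cong₂ _+_ (form-0ˡ A 0v (λ _ → refl)) (proj₂ (proj₂ FB) q q′ (s≢s′ ∘ cong inj₂)))

  combined : Frame A → Frame B → Frame C
  combined FA FB =
    slot FA FB ∘ splitAt ra ,
    slot-norm FA FB ∘ splitAt ra ,
    λ I J I≢J → slot-orth FA FB (splitAt ra I) (splitAt ra J) (I≢J ∘ splitAt-injective I J)
    where
      splitAt-injective : ∀ I J → splitAt ra I ≡ splitAt ra J → I ≡ J
      splitAt-injective I J e =
        trans (sym (join-splitAt ra rb I)) (trans (cong (Fin.join ra rb) e) (join-splitAt ra rb J))

  -- Combining pairwise disjoint frames gives disjoint frames: equal (or opposite)
  -- slots would have equal (or opposite) components, and a root is never 0.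
  slot-disjoint : ∀ {FA FA′ FB FB′} → DisjointFrames A FA FA′ → DisjointFrames B FB FB′ →
    ∀ s s′ → ¬ (slot FA FB s ≈v slot FA′ FB′ s′) ×
             ¬ (slot FA FB s ≈v (-v (slot FA′ FB′ s′)))
  slot-disjoint {FA} disA disB (inj₁ p) (inj₁ p′) =
    (λ e → proj₁ (disA p p′) (≈v-trans (left-of e) (left-join _ _))) ,
    (λ e → proj₂ (disA p p′) (≈v-trans (left-of e) (-v-cong (left-join _ _))))
  slot-disjoint {FA} disA disB (inj₁ p) (inj₂ q) =
    (λ e → root-nonzero (proj₁ (proj₂ FA) p) (≈v-trans (left-of e) (left-join 0v _))) ,
    (λ e → root-nonzero (proj₁ (proj₂ FA) p) (≈v-trans (left-of e) (-v-cong (left-join 0v _))))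
  slot-disjoint {FB = FB} disA disB (inj₂ q) (inj₁ p) =
    (λ e → root-nonzero (proj₁ (proj₂ FB) q) (≈v-trans (right-of e) (right-join _ 0v))) ,
    (λ e → root-nonzero (proj₁ (proj₂ FB) q) (≈v-trans (right-of e) (-v-cong (right-join _ 0v))))
  slot-disjoint disA disB (inj₂ q) (inj₂ q′) =
    (λ e → proj₁ (disB q q′) (≈v-trans (right-of e) (right-join _ _))) ,
    (λ e → proj₂ (disB q q′) (≈v-trans (right-of e) (-v-cong (right-join _ _))))

  combined-disjoint : ∀ {FA FA′ FB FB′} → DisjointFrames A FA FA′ → DisjointFrames B FB FB′ →
    DisjointFrames C (combined FA FB) (combined FA′ FB′)
  combined-disjoint disA disB I J = slot-disjoint disA disB (splitAt ra I) (splitAt ra J)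

even-plus-two : ∀ na nb nt → na ≡ nt ℕ.+ nt → na ℕ.+ nb ≡ 2 →
  (na ≡ 2 × nb ≡ 0) ⊎ (na ≡ 0 × nb ≡ 2)
even-plus-two 0 _ _ _ refl = inj₂ (refl , refl)
even-plus-two 1 _ nt one≡nt+nt refl = ⊥-elim (one-odd nt one≡nt+nt)
  where
    one-odd : ∀ t → 1 ≢ t ℕ.+ t
    one-odd (suc t) e with trans (ℕ.suc-injective e) (ℕ.+-suc t t)
    ... | ()
even-plus-two 2 _ _ _ refl = inj₁ (refl , refl)
even-plus-two (suc (suc (suc _))) _ _ _ ()

even-plus-two-ℤ : ∀ a b t → a ≡ t + t → + 0 ℤ.≤ a → + 0 ℤ.≤ b → a + b ≡ + 2 →
  (a ≡ + 2 × b ≡ + 0) ⊎ (a ≡ + 0 × b ≡ + 2)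
even-plus-two-ℤ (+ na) (+ nb) (+ nt) a≡t+t _ _ a+b≡2
  with even-plus-two na nb nt (+-injective a≡t+t) (+-injective a+b≡2)
... | inj₁ (refl , refl) = inj₁ (refl , refl)
... | inj₂ (refl , refl) = inj₂ (refl , refl)
even-plus-two-ℤ (+ na) (+ nb) -[1+ nt ] () _ _ _

module Restriction {C A B : Lat} (S : OrthogonalSplitting C A B)
  (pdA : PositiveDefinite A) (pdB : PositiveDefinite B) (evA : Even A) where
  open OrthogonalSplitting S

  InA : Vecℤ (rank C) → Set
  InA z = form A (π z) (π z) ≡ + 2

  -- A root of C lies in A or in B: the norms of its components are
  -- nonnegative, sum to 2, and the A-norm is even.
  root-components : ∀ {z} → form C z z ≡ + 2 →
    (InA z × ρ z ≈v 0v) ⊎ (π z ≈v 0v × form B (ρ z) (ρ z) ≡ + 2)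
  root-components {z} z-root
    with even-plus-two-ℤ (form A (π z) (π z)) (form B (ρ z) (ρ z)) (proj₁ (evA (π z)))
           (proj₂ (evA (π z))) (form-nonneg pdA (π z)) (form-nonneg pdB (ρ z))
           (trans (sym (form-split z z)) z-root)
  ... | inj₁ (A-root , B-null) = inj₁ (A-root , norm-zero pdB B-null)
  ... | inj₂ (A-null , B-root) = inj₂ (norm-zero pdA A-null , B-root)

  A-root-in-A : ∀ {z} → form C z z ≡ + 2 → InA z → ρ z ≈v 0v
  A-root-in-A z-root z∈A with root-components z-root
  ... | inj₁ (_ , ρz≈0) = ρz≈0
  ... | inj₂ (πz≈0 , _) = ⊥-elim (root-nonzero z∈A πz≈0)

  other-root-in-B : ∀ {z} → form C z z ≡ + 2 → ¬ InA z →
    π z ≈v 0v × form B (ρ z) (ρ z) ≡ + 2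
  other-root-in-B z-root z∉A with root-components z-root
  ... | inj₁ (z∈A , _) = ⊥-elim (z∉A z∈A)
  ... | inj₂ in-B      = in-B

  form-via-A : ∀ {z} w → ρ z ≈v 0v → form C z w ≡ form A (π z) (π w)
  form-via-A {z} w ρz≈0 = trans (form-split z w)
    (trans (cong (_+_ (form A (π z) (π w))) (form-0ˡ B (ρ w) ρz≈0)) (+-identityʳ _))

  form-via-B : ∀ {z} w → π z ≈v 0v → form C z w ≡ form B (ρ z) (ρ w)
  form-via-B {z} w πz≈0 = trans (form-split z w)
    (trans (cong (_+ form B (ρ z) (ρ w)) (form-0ˡ A (π w) πz≈0)) (+-identityˡ _))

  A-component-determines : ∀ {z w} → ρ z ≈v 0v → ρ w ≈v 0v → π z ≈v π w → z ≈v w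
  A-component-determines ρz≈0 ρw≈0 e =
    components-determine e (λ i → trans (ρz≈0 i) (sym (ρw≈0 i)))

  -- At least rank A vectors of a 2-frame of C lie in A: those outside A have
  -- pairwise orthogonal root B-components, so there are at most rank B of them.
  A-indices : (F : Frame C) → Σ (Fin (rank A) → Fin (rank C)) λ idx →
    (∀ p → InA (proj₁ F (idx p))) × (∀ p q → idx p ≡ idx q → p ≡ q)
  A-indices (v , v-norm , v-orth) =
    index inA ∘ embed , holds inA ∘ embed ,
    λ p q e → inject≤-injective enough enough p q (injective inA _ _ e)
    where
      parts = partition (rank C) (λ i → form A (π (v i)) (π (v i)) ≟ + 2)
      inA   = proj₁ parts
      notA  = proj₁ (proj₂ parts)
      sizes = proj₂ (proj₂ parts)
      B-part : Fin (size notA) → Vecℤ (rank B)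
      B-part j = ρ (v (index notA j))
      in-B : ∀ j → π (v (index notA j)) ≈v 0v × form B (B-part j) (B-part j) ≡ + 2
      in-B j = other-root-in-B (v-norm (index notA j)) (holds notA j)
      few-outside : size notA ℕ.≤ rank B
      few-outside = orthogonal-roots-bound B B-part (proj₂ ∘ in-B)
        (λ j k j≢k → trans (sym (form-via-B (v (index notA k)) (proj₁ (in-B j))))
                           (v-orth _ _ (j≢k ∘ injective notA j k)))
      enough : rank A ℕ.≤ size inA
      enough = ℕ.+-cancelʳ-≤ (rank B) (rank A) (size inA)
        (subst (ℕ._≤ size inA ℕ.+ rank B) (trans sizes rank-split)
               (ℕ.+-monoʳ-≤ (size inA) few-outside))
      embed : Fin (rank A) → Fin (size inA)
      embed p = inject≤ p enough

  restrict : Frame C → Frame A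
  restrict F@(v , v-norm , v-orth) =
    (λ p → π (v (idx p))) , in-A ,
    λ p q p≢q → trans (sym (form-via-A (v (idx q)) (A-root-in-A (v-norm (idx p)) (in-A p))))
                      (v-orth (idx p) (idx q) (p≢q ∘ idx-injective p q))
    where
      idx = proj₁ (A-indices F)
      in-A = proj₁ (proj₂ (A-indices F))
      idx-injective = proj₂ (proj₂ (A-indices F))

  -- Restriction preserves disjointness: vectors with vanishing B-component that
  -- agree up to sign in A agree up to sign in C.
  restrict-disjoint : ∀ {F F′} → DisjointFrames C F F′ →
    DisjointFrames A (restrict F) (restrict F′)
  restrict-disjoint {F@(v , v-norm , _)} {F′@(w , w-norm , _)} disjoint p q =
    (λ e → proj₁ (disjoint (idx p) (idx′ q)) (A-component-determines ρx≈0 ρy≈0 e)) ,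
    (λ e → proj₂ (disjoint (idx p) (idx′ q))
             (A-component-determines ρx≈0 ρ-y≈0 (≈v-trans e -πy≈π-y)))
    where
      idx  = proj₁ (A-indices F)
      idx′ = proj₁ (A-indices F′)
      x = v (idx p)
      y = w (idx′ q)
      ρx≈0 : ρ x ≈v 0v
      ρx≈0 = A-root-in-A (v-norm (idx p)) (proj₁ (proj₂ (A-indices F)) p)
      ρy≈0 : ρ y ≈v 0v
      ρy≈0 = A-root-in-A (w-norm (idx′ q)) (proj₁ (proj₂ (A-indices F′)) q)
      ρ-y≈0 : ρ (-v y) ≈v 0v
      ρ-y≈0 = ≈v-trans (ρ-neg y) (-v-cong ρy≈0)
      -πy≈π-y : (-v (π y)) ≈v π (-v y)
      -πy≈π-y i = sym (π-neg y i)

  restrict-family : ∀ {m} {F : Fin m → Frame C} → PairwiseDisjointFamily C m F →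
    PairwiseDisjointFamily A m (restrict ∘ F)
  restrict-family {F = F} disjoint a b a≢b =
    restrict-disjoint {F a} {F b} (disjoint a b a≢b)

-- Lower bound: combine the t-th frames of A and of B.  Upper bound: a disjoint
-- family of frames of A ⊥ B restricts to one in A and to one in B.
⊥-max-frames : ∀ {A B a b} → PositiveDefinite A → PositiveDefinite B → Even A → Even B →
  IsMaxDisjointFrames A a → IsMaxDisjointFrames B b → IsMaxDisjointFrames (A ⊥L B) (a ⊓ b)
⊥-max-frames {A} {B} {a} {b} pdA pdB evA evB ((FA , disA) , maxA) ((FB , disB) , maxB) =
  (family , family-disjoint) ,
  λ m F disjoint → ℕ.⊓-glb (maxA m (toA.restrict ∘ F) (toA.restrict-family {F = F} disjoint))
                           (maxB m (toB.restrict ∘ F) (toB.restrict-family {F = F} disjoint))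
  where
    module toA = Restriction (⊥-splitting A B) pdA pdB evA
    module toB = Restriction (swap-splitting (⊥-splitting A B)) pdB pdA evB
    a⊓b≤a = ℕ.m⊓n≤m a b
    a⊓b≤b = ℕ.m⊓n≤n a b
    family : Fin (a ⊓ b) → Frame (A ⊥L B)
    family t = combined A B (FA (inject≤ t a⊓b≤a)) (FB (inject≤ t a⊓b≤b))
    family-disjoint : PairwiseDisjointFamily (A ⊥L B) (a ⊓ b) family
    family-disjoint t t′ t≢t′ = combined-disjoint A B
      (disA _ _ (t≢t′ ∘ inject≤-injective a⊓b≤a a⊓b≤a t t′))
      (disB _ _ (t≢t′ ∘ inject≤-injective a⊓b≤b a⊓b≤b t t′))

⊥ᵢ-positive-even : ∀ k (L : Fin (suc k) → Lat) →
  (∀ i → IsLattice (L i)) → (∀ i → IsRootLattice (L i)) →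
  PositiveDefinite (⊥ᵢ L) × Even (⊥ᵢ L)
⊥ᵢ-positive-even zero    L lattice root =
  proj₂ (lattice zero) , rootLattice-even (lattice zero) (root zero)
⊥ᵢ-positive-even (suc k) L lattice root =
  ⊥-positive (L zero) (⊥ᵢ (L ∘ suc)) (proj₂ (lattice zero)) (proj₁ rest) ,
  ⊥-even (L zero) (⊥ᵢ (L ∘ suc)) (rootLattice-even (lattice zero) (root zero)) (proj₂ rest)
  where
    rest = ⊥ᵢ-positive-even k (L ∘ suc) (lattice ∘ suc) (root ∘ suc)

-- Lemma 2.1: m(⊥ᵢ Lᵢ) = minᵢ m(Lᵢ), by induction on the number of summands.
lemma2p1 : (k : ℕ) (L : Fin (suc k) → Lat) →
    (∀ i → IsLattice (L i)) →
    (∀ i → IsRootLattice (L i)) →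
    (∀ i → Irreducible (L i)) →
    (m : Fin (suc k) → ℕ) →
    (∀ i → IsMaxDisjointFrames (L i) (m i)) →
    IsMaxDisjointFrames (⊥ᵢ L) (minᵢ m)
lemma2p1 zero    L lattice root irreducible m max = max zero
lemma2p1 (suc k) L lattice root irreducible m max =
  ⊥-max-frames (proj₂ (lattice zero)) (proj₁ rest)
               (rootLattice-even (lattice zero) (root zero)) (proj₂ rest)
               (max zero)
               (lemma2p1 k (L ∘ suc) (lattice ∘ suc) (root ∘ suc) (irreducible ∘ suc)
                           (m ∘ suc) (max ∘ suc))
  where
    rest = ⊥ᵢ-positive-even k (L ∘ suc) (lattice ∘ suc) (root ∘ suc)
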